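{- Let $A,B\subseteq\{0,1\}^d$ with $|A|=|B|=n$, and let $k=\lceil\log_2 n\rceil$. Let $G$ be the $\{0,1,\mathtt{c}\}$-labeled directed graph with two components $G_A$ and $G_B$ constructed as follows. $G_B$: take a complete binary tree $T$ with $k+1$ levels (edges directed away from the root) and $2^k\ge n$ leaves, whose root is labeled $\mathtt{c}$, every left child labeled $0$ and every right child labeled $1$; for each $b\in B$ build a DAG $\overline{G}_b$ with $d+1$ levels, where level $0$ is a single $\mathtt{c}$-labeled source, level $i\ge1$ has a $0$-labeled and a $1$-labeled vertex if $b[i]=0$ and only a $0$-labeled vertex if $b[i]=1$, and every vertex of level $i$ has an edge to every vertex of level $i+1$; add an edge from each of $n$ distinct leaves of $T$ to the source of a distinct $\overline{G}_b$ ($b\in B$). $G_A$: take a DAG $U$ consisting of a $\mathtt{c}$-labeled source followed by $k$ levels each containing a $0$-labeled and a $1$-labeled vertex, with every vertex of a level (including the source) having an edge to every vertex of the next level; take the keyword tree (trie) $K$ of the strings $\mathtt{c}a[1]\cdots a[d]$, $a\in A$ (a rooted tree with edges directed away from the root, one vertex per distinct prefix, labeled with the last character of that prefix, so that root-to-leaf paths spell exactly these strings); add edges from both vertices of the last level of $U$ to the root of $K$. Then $G$ is a deterministic DAG, and $G$ has a repeated string of length $k+d+2$ if and only if there exist $a\in A$, $b\in B$ with $a\cdot b=\sum_{i=1}^d a[i]b[i]=0$.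
   Context: A labeled graph $G=(V,E,L)$ has $L\colon V\to\Sigma$; it is deterministic if for every vertex the labels of its out-neighbors are pairwise distinct. A walk is a sequence of vertices with consecutive vertices joined by edges; its spelling is its sequence of labels. A string is repeated in $G$ if it is spelled by two distinct walks (differing at some index). -}

module Defs where

open import Data.Nat using (ℕ; zero; suc; _+_; _*_; _≤?_)
open import Data.Nat.Logarithm using (⌈log₂_⌉)
open import Data.Bool using (Bool; true; false; not; _∧_; T)
open import Data.Bool.Properties using () renaming (_≟_ to _≟B_)
open import Data.Fin using (Fin; toℕ)
open import Data.Fin.Properties using (any?)
open import Data.List using (List; []; _∷_; _∷ʳ_; length; take)
open import Data.List.Properties using (≡-dec)
open import Data.Vec using (Vec; lookup; toList; zipWith; head; last)
open import Data.Vec as V using ()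
open import Data.Product using (Σ; ∃; _×_; _,_)
open import Relation.Nullary using (¬_)
open import Data.Unit using (⊤)
open import Relation.Nullary.Decidable using (True)
open import Relation.Binary.PropositionalEquality using (_≡_; _≢_)

record LGraph (Sym : Set) : Set₁ where
  field
    V : Set
    E : V → V → Set
    L : V → Sym

module _ {Sym : Set} (G : LGraph Sym) where
  open LGraph G

  Deterministic : Set
  Deterministic = ∀ u v w → E u v → E u w → v ≢ w → L v ≢ L w

  IsWalk : ∀ {m} → Vec V m → Set
  IsWalk Vec.[] = ⊤
  IsWalk (v Vec.∷ Vec.[]) = ⊤
  IsWalk (u Vec.∷ v Vec.∷ w) = E u v × IsWalk (v Vec.∷ w)

  spelling : ∀ {m} → Vec V m → Vec Sym m
  spelling = V.map L

  Repeated : ∀ {m} → Vec Sym m → Set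
  Repeated {m} s = Σ (Vec V m) λ w₁ → Σ (Vec V m) λ w₂ →
    IsWalk w₁ × IsWalk w₂ × spelling w₁ ≡ s × spelling w₂ ≡ s ×
    ∃ λ (i : Fin m) → lookup w₁ i ≢ lookup w₂ i

  HasRepeatedOfLength : ℕ → Set
  HasRepeatedOfLength m = ∃ λ (s : Vec Sym m) → Repeated s

  Acyclic : Set
  Acyclic = ∀ m (w : Vec V (suc (suc m))) → IsWalk w → head w ≢ last w

data Sym : Set where
  s0 s1 sc : Sym

bit : Bool → Sym
bit false = s0
bit true  = s1

lastSym : List Bool → Sym
lastSym []            = sc
lastSym (x ∷ [])      = bit x
lastSym (x ∷ y ∷ r)   = lastSym (y ∷ r)

b2n : Bool → ℕ
b2n false = 0
b2n true  = 1

dot : ∀ {d} → Vec Bool d → Vec Bool d → ℕ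
dot a b = V.sum (zipWith (λ x y → b2n x * b2n y) a b)

-- A, B : Fin n → Vec Bool d enumerate the two sets,
-- leaf : Fin n → Vec Bool k chooses the leaf of T (as the root-to-leaf
-- left(false)/right(true) path) attached to the gadget of B i.

module Construction (d n : ℕ) (A B : Fin n → Vec Bool d)
                    (leaf : Fin n → Vec Bool ⌈log₂ n ⌉) where

  k : ℕ
  k = ⌈log₂ n ⌉

  -- p is a prefix of some a ∈ A (the trie vertex for prefix c·p)
  prefix? : (p : List Bool) → _
  prefix? p = any? (λ i → ≡-dec _≟B_ (take (length p) (toList (A i))) p)

  data Vtx : Set where
    -- G_B: vertices of the complete binary tree T, by root-to-vertex path
    tnode : (p : List Bool) → True (length p ≤? k) → Vtx
    gsrc  : Fin n → Vtx
    -- G_B: vertex of level (l+1) of the gadget for B i with label x;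
    -- the 1-labelled vertex exists only if (B i)[l] = 0
    gnode : (i : Fin n) (l : Fin d) (x : Bool) → T (not (x ∧ lookup (B i) l)) → Vtx
    -- G_A: source of U, and vertex of level (l+1) of U with label x
    usrc  : Vtx
    unode : Fin k → Bool → Vtx
    -- G_A: trie vertex for the prefix c·p (p = [] is the root)
    knode : (p : List Bool) → True (prefix? p) → Vtx

  label : Vtx → Sym
  label (tnode p _)     = lastSym p
  label (gsrc _)        = sc
  label (gnode _ _ x _) = bit x
  label usrc            = sc
  label (unode _ x)     = bit x
  label (knode p _)     = lastSym p

  data Edge : Vtx → Vtx → Set where
    t-t  : ∀ p x {h h′} → Edge (tnode p h) (tnode (p ∷ʳ x) h′)
    t-g  : ∀ i {h} → Edge (tnode (toList (leaf i)) h) (gsrc i)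
    g-s  : ∀ i (l : Fin d) x {h} → toℕ l ≡ 0 → Edge (gsrc i) (gnode i l x h)
    g-g  : ∀ i (l l′ : Fin d) x y {h h′} → toℕ l′ ≡ suc (toℕ l) →
           Edge (gnode i l x h) (gnode i l′ y h′)
    u-s  : ∀ (l : Fin k) x → toℕ l ≡ 0 → Edge usrc (unode l x)
    u-u  : ∀ (l l′ : Fin k) x y → toℕ l′ ≡ suc (toℕ l) → Edge (unode l x) (unode l′ y)
    -- last level of U to the root of K (if k = 0 the last level is the source)
    u-k  : ∀ (l : Fin k) x {h} → suc (toℕ l) ≡ k → Edge (unode l x) (knode [] h)
    us-k : ∀ {h} → k ≡ 0 → Edge usrc (knode [] h)
    k-k  : ∀ p x {h h′} → Edge (knode p h) (knode (p ∷ʳ x) h′)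

  G : LGraph Sym
  G = record { V = Vtx ; E = Edge ; L = label }

-- Let the rank of a vertex be its distance from the source of its component, so that the
-- gadget sources and the trie root have rank k + 1 and no rank exceeds k + d + 1.  Every edge
-- raises the rank by one, which gives acyclicity, and two walks spelling a string of length
-- k + d + 2 must start at the two sources, the roots of T and of U (distinct by determinism).
-- Both spell c, then k bits, then c again at a gadget source resp. the trie root, then d more
-- symbols.  Below the trie root these are a prefix of some a ∈ A, below the source of the gadget
-- of b they are bitwise disjoint from a prefix of b; at full length d this says a · b = 0.
-- Conversely, for such a and b both roots spell c · leaf(b) · c · a.
module Submission where

open import Defs
open import Data.Nat using (ℕ; zero; suc; _+_; _⊓_; _≤_; _<_; z≤n; s≤s)
open import Data.Nat.Properties
open import Data.Nat.Logarithm using (⌈log₂_⌉)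
open import Data.Bool using (Bool; true; false; not; _∧_; T)
open import Data.Bool.Properties using (T-irrelevant)
open import Data.Fin as Fin using (Fin; toℕ; fromℕ<)
open import Data.Fin.Properties using (toℕ-injective; toℕ<n; toℕ-fromℕ<)
open import Data.List using (List; []; _∷_; _∷ʳ_; _++_; [_]; length; map; take; drop)
open import Data.List.Properties
  using (∷-injectiveˡ; ∷-injectiveʳ; ++-assoc; ++-identityʳ; length-++; length-++-≤ˡ; length-map;
         length-take; take-all; map-injective)
open import Data.List.Relation.Binary.Prefix.Heterogeneous using (Prefix; []; _∷_)
open import Data.Vec as V using (Vec; []; _∷_; toList; lookup; head; last)
open import Data.Vec.Properties using (length-toList; toList-injective; cast-is-id)
  renaming (∷-injective to ∷-injective-Vec; ∷-injectiveˡ to ∷-injectiveˡ-Vec; ∷-injectiveʳ to ∷-injectiveʳ-Vec)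
open import Data.Product using (Σ; ∃; ∃₂; _×_; _,_)
open import Data.Sum using (_⊎_; inj₁; inj₂)
open import Data.Empty using (⊥-elim)
open import Data.Unit using (tt)
open import Function using (_∘_)
open import Function.Bundles using (_⇔_; mk⇔)
open import Function.Definitions using (Injective)
open import Relation.Nullary.Decidable using (True; toWitness; fromWitness)
open import Relation.Binary.PropositionalEquality using (_≡_; _≢_; refl; sym; trans; cong; cong₂; subst; subst₂)

module _ {Sym : Set} (G : LGraph Sym) where
  open LGraph G

  data Path (u : V) : List Sym → Set where
    []  : Path u []
    _∷_ : ∀ {v s} → E u v → Path v s → Path u (L v ∷ s)

  path-∷ : ∀ {u v c s} → E u v → L v ≡ c → Path v s → Path u (c ∷ s)
  path-∷ e refl p = e ∷ p

  OutLabelInjective : Set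
  OutLabelInjective = ∀ {u v w} → E u v → E u w → L v ≡ L w → v ≡ w

  outLabelInjective⇒deterministic : OutLabelInjective → Deterministic G
  outLabelInjective⇒deterministic inj _ _ _ e₁ e₂ v≢w Lv≡Lw = v≢w (inj e₁ e₂ Lv≡Lw)

  walk⇒path : ∀ {m u} (r : Vec V m) → IsWalk G (u ∷ r) → Path u (toList (spelling G r))
  walk⇒path []      _       = []
  walk⇒path (_ ∷ r) (e , w) = e ∷ walk⇒path r w

  path⇒walk : ∀ {u s} → Path u s →
              Σ (Vec V (length s)) λ r → IsWalk G (u ∷ r) × spelling G r ≡ V.fromList s
  path⇒walk [] = [] , tt , refl
  path⇒walk (_∷_ {v} e p) with r , w , sp ← path⇒walk p = v ∷ r , (e , w) , cong (L v ∷_) sp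

  walk-unique : OutLabelInjective → ∀ {m u} {r₁ r₂ : Vec V m} →
                IsWalk G (u ∷ r₁) → IsWalk G (u ∷ r₂) → spelling G r₁ ≡ spelling G r₂ → r₁ ≡ r₂
  walk-unique inj {r₁ = []}     {[]}     _        _        _  = refl
  walk-unique inj {r₁ = _ ∷ _}  {_ ∷ _}  (e₁ , w₁) (e₂ , w₂) sp
    with refl ← inj e₁ e₂ (∷-injectiveˡ-Vec sp)
    = cong (_ ∷_) (walk-unique inj w₁ w₂ (∷-injectiveʳ-Vec sp))

  Forked : ℕ → Set
  Forked m = ∃₂ λ u v → ∃ λ s →
    u ≢ v × L u ≡ L v × length s ≡ m × Path u s × Path v s

  repeated⇒forked : OutLabelInjective → ∀ {m} → HasRepeatedOfLength G (suc m) → Forked m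
  repeated⇒forked inj (_ , u₁ ∷ r₁ , u₂ ∷ r₂ , w₁ , w₂ , refl , sp , i , differ)
    with Lu₂≡Lu₁ , r₂≡r₁ ← ∷-injective-Vec sp =
    u₁ , u₂ , toList (spelling G r₁) , u₁≢u₂ , sym Lu₂≡Lu₁ , length-toList (spelling G r₁) ,
    walk⇒path r₁ w₁ , subst (Path u₂ ∘ toList) r₂≡r₁ (walk⇒path r₂ w₂)
    where
      u₁≢u₂ : u₁ ≢ u₂
      u₁≢u₂ refl = differ (cong (λ w → lookup (u₁ ∷ w) i) (walk-unique inj w₁ w₂ (sym r₂≡r₁)))

  forked⇒repeated : ∀ {m} → Forked m → HasRepeatedOfLength G (suc m)
  forked⇒repeated (u , v , s , u≢v , Lu≡Lv , refl , pu , pv)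
    with r₁ , w₁ , sp₁ ← path⇒walk pu | r₂ , w₂ , sp₂ ← path⇒walk pv =
    L u ∷ V.fromList s , u ∷ r₁ , v ∷ r₂ , w₁ , w₂ ,
    cong (L u ∷_) sp₁ , cong₂ _∷_ (sym Lu≡Lv) sp₂ , Fin.zero , u≢v

module _ {Sym : Set} (G : LGraph Sym) (rank : LGraph.V G → ℕ)
         (rank-< : ∀ {u v} → LGraph.E G u v → rank u < rank v) where
  open LGraph G

  walk-rank-< : ∀ {m} (w : Vec V (suc (suc m))) → IsWalk G w → rank (head w) < rank (last w)
  walk-rank-< (_ ∷ _ ∷ [])    (e , _) = rank-< e
  walk-rank-< (_ ∷ v ∷ x ∷ w) (e , p) = <-trans (rank-< e) (walk-rank-< (v ∷ x ∷ w) p)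

  graded⇒acyclic : Acyclic G
  graded⇒acyclic _ w p head≡last = <-irrefl (cong rank head≡last) (walk-rank-< w p)

  length+rank≤ : ∀ {b u s} → (∀ v → rank v ≤ b) → Path G u s → length s + rank u ≤ b
  length+rank≤ bound [] = bound _
  length+rank≤ {u = u} bound (_∷_ {s = s} e p) = begin
    suc (length s + rank u) ≡⟨ +-suc (length s) (rank u) ⟨
    length s + suc (rank u) ≤⟨ +-monoʳ-≤ (length s) (rank-< e) ⟩
    length s + rank _       ≤⟨ length+rank≤ bound p ⟩
    _                       ∎
    where open ≤-Reasoning

lastSym-∷ʳ : ∀ p x → lastSym (p ∷ʳ x) ≡ bit x
lastSym-∷ʳ []          x = refl
lastSym-∷ʳ (_ ∷ [])    x = refl
lastSym-∷ʳ (_ ∷ y ∷ p) x = lastSym-∷ʳ (y ∷ p) x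

bit-injective : Injective _≡_ _≡_ bit
bit-injective {false} {false} _ = refl
bit-injective {true}  {true}  _ = refl

bit≢sc : ∀ {x} → bit x ≢ sc
bit≢sc {false} ()
bit≢sc {true}  ()

bits≢bits++sc∷ : ∀ t t′ {s} → map bit t ≢ map bit t′ ++ sc ∷ s
bits≢bits++sc∷ []      []       ()
bits≢bits++sc∷ (_ ∷ _) []       eq = bit≢sc (∷-injectiveˡ eq)
bits≢bits++sc∷ (_ ∷ t) (_ ∷ t′) eq = bits≢bits++sc∷ t t′ (∷-injectiveʳ eq)

bits++sc∷-injectiveʳ : ∀ t t′ {s s′} → map bit t ++ sc ∷ s ≡ map bit t′ ++ sc ∷ s′ → s ≡ s′
bits++sc∷-injectiveʳ []      []       refl = refl
bits++sc∷-injectiveʳ []      (_ ∷ _)  eq   = ⊥-elim (bit≢sc (sym (∷-injectiveˡ eq)))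
bits++sc∷-injectiveʳ (_ ∷ _) []       eq   = ⊥-elim (bit≢sc (∷-injectiveˡ eq))
bits++sc∷-injectiveʳ (_ ∷ t) (_ ∷ t′) eq   =
  bits++sc∷-injectiveʳ t t′ (∷-injectiveʳ eq)

length-bits++sc∷bits : ∀ t a → length (map bit t ++ sc ∷ map bit a) ≡ suc (length t + length a)
length-bits++sc∷bits t a =
  trans (length-++ (map bit t)) (trans (cong₂ (λ x y → x + suc y) (length-map bit t) (length-map bit a)) (+-suc _ _))

bits-suffix-length : ∀ {t a m n} → length t ≡ m → length (map bit t ++ sc ∷ map bit a) ≡ suc (m + n) →
                     length a ≡ n
bits-suffix-length {t} {a} refl eq =
  +-cancelˡ-≡ (length t) _ _ (suc-injective (trans (sym (length-bits++sc∷bits t a)) eq))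

Disjoint : Bool → Bool → Set
Disjoint x y = T (not (x ∧ y))

dot≡0⇒disjoint : ∀ {m} (a b : Vec Bool m) → dot a b ≡ 0 → Prefix Disjoint (toList a) (toList b)
dot≡0⇒disjoint []           []           _  = []
dot≡0⇒disjoint (false ∷ a)  (_ ∷ b)      eq = tt ∷ dot≡0⇒disjoint a b eq
dot≡0⇒disjoint (true ∷ a)   (false ∷ b)  eq = tt ∷ dot≡0⇒disjoint a b eq

disjoint⇒dot≡0 : ∀ {m} (a b : Vec Bool m) → Prefix Disjoint (toList a) (toList b) → dot a b ≡ 0
disjoint⇒dot≡0 []          []          _        = refl
disjoint⇒dot≡0 (false ∷ a) (_ ∷ b)     (_ ∷ ab) = disjoint⇒dot≡0 a b ab
disjoint⇒dot≡0 (true ∷ a)  (false ∷ b) (_ ∷ ab) = disjoint⇒dot≡0 a b ab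

drop-toList : ∀ {A : Set} {m} (v : Vec A m) (l : Fin m) →
              drop (toℕ l) (toList v) ≡ lookup v l ∷ drop (suc (toℕ l)) (toList v)
drop-toList (_ ∷ _) Fin.zero    = refl
drop-toList (_ ∷ v) (Fin.suc l) = drop-toList v l

drop-toList-∷ : ∀ {A : Set} {m} (v : Vec A m) {n x xs} → drop n (toList v) ≡ x ∷ xs →
                ∃ λ (l : Fin m) → toℕ l ≡ n × lookup v l ≡ x × drop (suc n) (toList v) ≡ xs
drop-toList-∷ (_ ∷ _) {zero}  refl = Fin.zero , refl , refl , refl
drop-toList-∷ (_ ∷ v) {suc n} eq
  with l , refl , x≡ , xs≡ ← drop-toList-∷ v {n} eq = Fin.suc l , refl , x≡ , xs≡

disjoint-∷ : ∀ {m} (b : Vec Bool m) {l : Fin m} {n x t} → toℕ l ≡ n → Disjoint x (lookup b l) →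
             Prefix Disjoint t (drop (suc (toℕ l)) (toList b)) → Prefix Disjoint (x ∷ t) (drop n (toList b))
disjoint-∷ b {l} refl x⊥ t⊥ rewrite drop-toList b l = x⊥ ∷ t⊥

length-∷ʳ : ∀ {A : Set} (p : List A) x → length (p ∷ʳ x) ≡ suc (length p)
length-∷ʳ p x = trans (length-++ p) (+-comm (length p) 1)

take-length-++ : ∀ {A : Set} (p q : List A) → take (length p) (p ++ q) ≡ p
take-length-++ []      q = refl
take-length-++ (x ∷ p) q = cong (x ∷_) (take-length-++ p q)

level-shift : ∀ {k} {l l′ : Fin k} → toℕ l′ ≡ suc (toℕ l) → ∀ m → toℕ l + suc m ≡ toℕ l′ + m
level-shift {l = l} e m = trans (+-suc (toℕ l) m) (cong (_+ m) (sym e))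

module ConstructionProperties (d n : ℕ) (A B : Fin n → Vec Bool d)
                              (leaf : Fin n → Vec Bool ⌈log₂ n ⌉) where
  open Construction d n A B leaf

  tnode-cong : ∀ {p q h h′} → p ≡ q → tnode p h ≡ tnode q h′
  tnode-cong refl = cong (tnode _) (T-irrelevant _ _)

  knode-cong : ∀ {p q h h′} → p ≡ q → knode p h ≡ knode q h′
  knode-cong refl = cong (knode _) (T-irrelevant _ _)

  gnode-cong : ∀ {i l l′ x y h h′} → l ≡ l′ → x ≡ y → gnode i l x h ≡ gnode i l′ y h′
  gnode-cong refl refl = cong (gnode _ _ _) (T-irrelevant _ _)

  prefix-length≤ : ∀ {p} → True (prefix? p) → length p ≤ d
  prefix-length≤ {p} h with i , eq ← toWitness h = begin
    length p                                    ≡⟨ cong length eq ⟨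
    length (take (length p) (toList (A i)))     ≡⟨ length-take (length p) (toList (A i)) ⟩
    length p ⊓ length (toList (A i))            ≤⟨ m⊓n≤n (length p) _ ⟩
    length (toList (A i))                       ≡⟨ length-toList (A i) ⟩
    d                                           ∎
    where open ≤-Reasoning

  full-prefix : ∀ {p} → True (prefix? p) → length p ≡ d → ∃ λ i → p ≡ toList (A i)
  full-prefix {p} h len with i , eq ← toWitness h =
    i , trans (sym eq) (take-all (length p) (toList (A i)) (≤-reflexive (trans (length-toList (A i)) (sym len))))

  prefix-of : ∀ {i p q} → p ++ q ≡ toList (A i) → True (prefix? p)
  prefix-of {i} {p} {q} eq = fromWitness (i , subst (λ as → take (length p) as ≡ p) eq (take-length-++ p q))

  lastSym-∷ʳ-injective : ∀ p {x y} → lastSym (p ∷ʳ x) ≡ lastSym (p ∷ʳ y) → p ∷ʳ x ≡ p ∷ʳ y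
  lastSym-∷ʳ-injective p {x} {y} eq =
    cong (p ∷ʳ_) (bit-injective (trans (sym (lastSym-∷ʳ p x)) (trans eq (lastSym-∷ʳ p y))))

  tnode-out-injective : Injective _≡_ _≡_ leaf → ∀ {p p′ h h′ v w} →
    Edge (tnode p h) v → Edge (tnode p′ h′) w → p ≡ p′ → label v ≡ label w → v ≡ w
  tnode-out-injective _ (t-t p x) (t-t _ y) refl eq = tnode-cong (lastSym-∷ʳ-injective p eq)
  tnode-out-injective _ (t-t p x) (t-g _)   _    eq = ⊥-elim (bit≢sc (trans (sym (lastSym-∷ʳ p x)) eq))
  tnode-out-injective _ (t-g _)   (t-t p x) _    eq = ⊥-elim (bit≢sc (trans (sym (lastSym-∷ʳ p x)) (sym eq)))
  tnode-out-injective leaf-inj (t-g _) (t-g _) eq _ =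
    cong gsrc (leaf-inj (trans (sym (cast-is-id refl _)) (toList-injective refl _ _ eq)))

  outLabelInjective : Injective _≡_ _≡_ leaf → OutLabelInjective G
  outLabelInjective leaf-inj = inj
    where
      same-level : ∀ {m} {l l′ : Fin m} {n} → toℕ l ≡ n → toℕ l′ ≡ n → l ≡ l′
      same-level e e′ = toℕ-injective (trans e (sym e′))

      inj : OutLabelInjective G
      inj e₁@(t-t _ _)              e₂                         eq = tnode-out-injective leaf-inj e₁ e₂ refl eq
      inj e₁@(t-g _)                e₂                         eq = tnode-out-injective leaf-inj e₁ e₂ refl eq
      inj (g-s _ _ _ e)             (g-s _ _ _ e′)             eq = gnode-cong (same-level e e′) (bit-injective eq)
      inj (g-g _ _ _ _ _ e)         (g-g _ _ _ _ _ e′)         eq = gnode-cong (same-level e e′) (bit-injective eq)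
      inj (u-s _ _ e)               (u-s _ _ e′)               eq = cong₂ unode (same-level e e′) (bit-injective eq)
      inj (u-s _ _ _)               (us-k _)                   eq = ⊥-elim (bit≢sc eq)
      inj (us-k _)                  (u-s _ _ _)                eq = ⊥-elim (bit≢sc (sym eq))
      inj (us-k _)                  (us-k _)                   _  = knode-cong refl
      inj (u-u _ _ _ _ e)           (u-u _ _ _ _ e′)           eq = cong₂ unode (same-level e e′) (bit-injective eq)
      inj (u-u _ _ _ _ _)           (u-k _ _ _)                eq = ⊥-elim (bit≢sc eq)
      inj (u-k _ _ _)               (u-u _ _ _ _ _)            eq = ⊥-elim (bit≢sc (sym eq))
      inj (u-k _ _ _)               (u-k _ _ _)                _  = knode-cong refl
      inj (k-k p _)                 (k-k _ _)                  eq = knode-cong (lastSym-∷ʳ-injective p eq)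

  rank : Vtx → ℕ
  rank (tnode p _)     = length p
  rank (gsrc _)        = suc k
  rank (gnode _ l _ _) = suc (suc (k + toℕ l))
  rank usrc            = 0
  rank (unode l _)     = suc (toℕ l)
  rank (knode p _)     = suc (k + length p)

  rank-edge : ∀ {u v} → Edge u v → rank v ≡ suc (rank u)
  rank-edge (t-t p x)         = length-∷ʳ p x
  rank-edge (t-g i)           = cong suc (sym (length-toList (leaf i)))
  rank-edge (g-s _ _ _ e)     = trans (cong (λ z → suc (suc (k + z))) e) (cong (suc ∘ suc) (+-identityʳ k))
  rank-edge (g-g _ l _ _ _ e) = trans (cong (λ z → suc (suc (k + z))) e) (cong (suc ∘ suc) (+-suc k (toℕ l)))
  rank-edge (u-s _ _ e)       = cong suc e
  rank-edge (u-u _ _ _ _ e)   = cong suc e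
  rank-edge (u-k _ _ e)       = cong suc (trans (+-identityʳ k) (sym e))
  rank-edge (us-k e)          = cong suc (trans (+-identityʳ k) e)
  rank-edge (k-k p x)         = trans (cong (λ z → suc (k + z)) (length-∷ʳ p x)) (cong suc (+-suc k (length p)))

  rank-< : ∀ {u v} → Edge u v → rank u < rank v
  rank-< e = ≤-reflexive (sym (rank-edge e))

  rank≤ : ∀ v → rank v ≤ suc (k + d)
  rank≤ (tnode p h)     = m≤n⇒m≤1+n (≤-trans (toWitness h) (m≤m+n k d))
  rank≤ (gsrc _)        = s≤s (m≤m+n k d)
  rank≤ (gnode _ l _ _) = s≤s (subst (_≤ k + d) (+-suc k (toℕ l)) (+-monoʳ-≤ k (toℕ<n l)))
  rank≤ usrc            = z≤n
  rank≤ (unode l _)     = m≤n⇒m≤1+n (≤-trans (toℕ<n l) (m≤m+n k d))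
  rank≤ (knode p h)     = s≤s (+-monoʳ-≤ k (prefix-length≤ h))

  rank≡0 : ∀ {u} → rank u ≡ 0 → (∃ λ h → u ≡ tnode [] h) ⊎ u ≡ usrc
  rank≡0 {tnode [] h} _ = inj₁ (h , refl)
  rank≡0 {usrc}       _ = inj₂ refl

  long-path-source : ∀ {u s} → Path G u s → length s ≡ suc (k + d) → (∃ λ h → u ≡ tnode [] h) ⊎ u ≡ usrc
  long-path-source {u} p len = rank≡0 (n≤0⇒n≡0 (+-cancelˡ-≤ (suc (k + d)) _ _ bound))
    where
      bound : suc (k + d) + rank u ≤ suc (k + d) + 0
      bound = subst₂ _≤_ (cong (_+ rank u) len) (sym (+-identityʳ _)) (length+rank≤ G rank rank-< rank≤ p)

  gnode-path-spells : ∀ {j l x h s} → Path G (gnode j l x h) s →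
    ∃ λ t → s ≡ map bit t × Prefix Disjoint t (drop (suc (toℕ l)) (toList (B j)))
  gnode-path-spells [] = [] , refl , []
  gnode-path-spells (g-g j _ _ _ y {h′ = y⊥} e ∷ p)
    with t , refl , t⊥ ← gnode-path-spells p = y ∷ t , refl , disjoint-∷ (B j) e y⊥ t⊥

  gsrc-path-spells : ∀ {j s} → Path G (gsrc j) s → ∃ λ t → s ≡ map bit t × Prefix Disjoint t (toList (B j))
  gsrc-path-spells [] = [] , refl , []
  gsrc-path-spells (g-s j _ x {x⊥} e ∷ p)
    with t , refl , t⊥ ← gnode-path-spells p = x ∷ t , refl , disjoint-∷ (B j) e x⊥ t⊥

  gadget-path : ∀ {j u} m {t bs} → drop m (toList (B j)) ≡ bs → Prefix Disjoint t bs →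
                (∀ l x h → toℕ l ≡ m → Edge u (gnode j l x h)) → Path G u (map bit t)
  gadget-path m _ [] _ = []
  gadget-path {j} m eq (_∷_ {a = x} x⊥ t⊥) edge
    with l , refl , refl , refl ← drop-toList-∷ (B j) {m} eq =
    edge l x x⊥ refl ∷ gadget-path (suc m) refl t⊥ (λ l′ y _ e → g-g j l l′ x y e)

  gsrc-path : ∀ {j t} → Prefix Disjoint t (toList (B j)) → Path G (gsrc j) (map bit t)
  gsrc-path {j} t⊥ = gadget-path 0 refl t⊥ (λ l x _ e → g-s j l x e)

  knode-path-spells : ∀ {p h s} → Path G (knode p h) s → ∃ λ t → s ≡ map bit t × True (prefix? (p ++ t))
  knode-path-spells {p} {h} [] = [] , refl , subst (True ∘ prefix?) (sym (++-identityʳ p)) h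
  knode-path-spells (k-k p x ∷ q) with t , refl , h ← knode-path-spells q =
    x ∷ t , cong (_∷ map bit t) (lastSym-∷ʳ p x) , subst (True ∘ prefix?) (++-assoc p [ x ] t) h

  knode-path : ∀ {i p q h} → p ++ q ≡ toList (A i) → Path G (knode p h) (map bit q)
  knode-path {q = []}    _  = []
  knode-path {p = p} {x ∷ q} eq =
    path-∷ G (k-k p x {h′ = prefix-of eq′}) (lastSym-∷ʳ p x) (knode-path eq′)
    where eq′ = trans (++-assoc p [ x ] q) eq

  tnode-path-spells : ∀ {p h s} → Path G (tnode p h) s →
    (∃ λ t → s ≡ map bit t) ⊎ (∃₂ λ j t → ∃ λ s′ → s ≡ map bit t ++ sc ∷ s′ × Path G (gsrc j) s′)
  tnode-path-spells [] = inj₁ ([] , refl)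
  tnode-path-spells (t-g j ∷ q) = inj₂ (j , [] , _ , refl , q)
  tnode-path-spells (t-t p x ∷ q) with tnode-path-spells q
  ... | inj₁ (t , refl)            = inj₁ (x ∷ t , cong (_∷ _) (lastSym-∷ʳ p x))
  ... | inj₂ (j , t , s′ , refl , g) = inj₂ (j , x ∷ t , s′ , cong (_∷ _) (lastSym-∷ʳ p x) , g)

  tnode-path : ∀ {j p q h s} → p ++ q ≡ toList (leaf j) → Path G (gsrc j) s →
               Path G (tnode p h) (map bit q ++ sc ∷ s)
  tnode-path {j} {p} {[]} eq g = leaf-edge (trans (sym (++-identityʳ p)) eq) ∷ g
    where
      leaf-edge : ∀ {p h} → p ≡ toList (leaf j) → Edge (tnode p h) (gsrc j)
      leaf-edge refl = t-g j
  tnode-path {j} {p} {x ∷ q} eq g =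
    path-∷ G (t-t p x {h′ = fromWitness depth}) (lastSym-∷ʳ p x) (tnode-path eq′ g)
    where
      eq′ = trans (++-assoc p [ x ] q) eq
      depth : length (p ∷ʳ x) ≤ k
      depth = ≤-trans (length-++-≤ˡ (p ∷ʳ x)) (≤-reflexive (trans (cong length eq′) (length-toList (leaf j))))

  unode-path-spells : ∀ {l x s} → Path G (unode l x) s → k ≤ toℕ l + length s →
    ∃₂ λ t s′ → ∃ λ h → s ≡ map bit t ++ sc ∷ s′ × suc (toℕ l + length t) ≡ k × Path G (knode [] h) s′
  unode-path-spells {l} [] k≤l = ⊥-elim (<⇒≱ (toℕ<n l) (subst (k ≤_) (+-identityʳ _) k≤l))
  unode-path-spells (u-u l _ _ y e ∷ p) k≤
    with t , s′ , h , refl , len , q ← unode-path-spells p (subst (k ≤_) (level-shift e _) k≤) =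
    y ∷ t , s′ , h , refl , trans (cong suc (level-shift e (length t))) len , q
  unode-path-spells (u-k _ _ {h} e ∷ p) _ = [] , _ , h , refl , trans (cong suc (+-identityʳ _)) e , p

  usrc-path-spells : ∀ {s} → Path G usrc s → k < length s →
    ∃₂ λ t s′ → ∃ λ h → s ≡ map bit t ++ sc ∷ s′ × length t ≡ k × Path G (knode [] h) s′
  usrc-path-spells (u-s _ x e ∷ p) (s≤s k≤)
    with t , s′ , h , refl , len , q ← unode-path-spells p (subst (λ z → k ≤ z + _) (sym e) k≤) =
    x ∷ t , s′ , h , refl , trans (cong (λ z → suc (z + length t)) (sym e)) len , q
  usrc-path-spells (us-k {h} e ∷ p) _ = [] , _ , h , refl , sym e , p

  unode-path : ∀ {l x q h s} → suc (toℕ l + length q) ≡ k → Path G (knode [] h) s →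
               Path G (unode l x) (map bit q ++ sc ∷ s)
  unode-path {l} {x} {[]} eq p = u-k l x (trans (cong suc (sym (+-identityʳ _))) eq) ∷ p
  unode-path {l} {x} {y ∷ q} eq p =
    u-u l (fromℕ< next) x y e ∷ unode-path (trans (cong suc (sym (level-shift e (length q)))) eq) p
    where
      next : suc (toℕ l) < k
      next = ≤-trans (s≤s (s≤s (m≤m+n (toℕ l) (length q))))
                     (≤-reflexive (trans (cong suc (sym (+-suc (toℕ l) (length q)))) eq))
      e = toℕ-fromℕ< next

  usrc-path : ∀ {q h s} → length q ≡ k → Path G (knode [] h) s → Path G usrc (map bit q ++ sc ∷ s)
  usrc-path {[]}    eq p = us-k (sym eq) ∷ p
  usrc-path {y ∷ q} eq p =
    u-s (fromℕ< 0<k) y (toℕ-fromℕ< 0<k) ∷ unode-path (trans (cong (λ z → suc (z + length q)) (toℕ-fromℕ< 0<k)) eq) p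
    where
      0<k : 0 < k
      0<k = subst (0 <_) eq (s≤s z≤n)

  common-spelling⇒orthogonal : ∀ {h s} → Path G (tnode [] h) s → Path G usrc s → length s ≡ suc (k + d) →
                               ∃₂ λ i j → dot (A i) (B j) ≡ 0
  common-spelling⇒orthogonal pT pU len
    with tA , sA , _ , refl , lenA , pK ← usrc-path-spells pU (subst (k <_) (sym len) (s≤s (m≤m+n k d)))
       | tnode-path-spells pT
  ... | inj₁ (tB , eq) = ⊥-elim (bits≢bits++sc∷ tB tA (sym eq))
  ... | inj₂ (j , tB , sB , eq , pG)
    with refl ← bits++sc∷-injectiveʳ tA tB eq
       | a , refl , a∈A ← knode-path-spells pK
       | b , a≡b , a⊥b ← gsrc-path-spells pG
    with refl ← map-injective bit-injective a≡b
       | i , refl ← full-prefix a∈A (bits-suffix-length {tA} {a} lenA len)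
    = i , j , disjoint⇒dot≡0 (A i) (B j) a⊥b

  forked⇒orthogonal : Forked G (suc (k + d)) → ∃₂ λ i j → dot (A i) (B j) ≡ 0
  forked⇒orthogonal (u , v , s , u≢v , _ , len , pu , pv)
    with long-path-source pu len | long-path-source pv len
  ... | inj₁ (_ , refl) | inj₁ (_ , refl) = ⊥-elim (u≢v (tnode-cong refl))
  ... | inj₂ refl       | inj₂ refl       = ⊥-elim (u≢v refl)
  ... | inj₁ (_ , refl) | inj₂ refl       = common-spelling⇒orthogonal pu pv len
  ... | inj₂ refl       | inj₁ (_ , refl) = common-spelling⇒orthogonal pv pu len

  orthogonal⇒forked : (∃₂ λ i j → dot (A i) (B j) ≡ 0) → Forked G (suc (k + d))
  orthogonal⇒forked (i , j , a·b≡0) =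
    tnode [] _ , usrc , map bit (toList (leaf j)) ++ sc ∷ map bit (toList (A i)) , (λ ()) , refl , len ,
    tnode-path refl pG , usrc-path (length-toList (leaf j)) pK
    where
      pG = gsrc-path (dot≡0⇒disjoint (A i) (B j) a·b≡0)
      pK = knode-path {h = prefix-of {q = toList (A i)} refl} refl
      len = trans (length-bits++sc∷bits (toList (leaf j)) (toList (A i)))
                  (cong₂ (λ x y → suc (x + y)) (length-toList (leaf j)) (length-toList (A i)))

lemma3 : (d n : ℕ) (A B : Fin n → Vec Bool d) →
         Injective _≡_ _≡_ A → Injective _≡_ _≡_ B →
         (leaf : Fin n → Vec Bool ⌈log₂ n ⌉) → Injective _≡_ _≡_ leaf →
         Deterministic (Construction.G d n A B leaf) ×
         Acyclic (Construction.G d n A B leaf) ×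
         (HasRepeatedOfLength (Construction.G d n A B leaf) (⌈log₂ n ⌉ + d + 2)
           ⇔ ∃₂ λ i j → dot (A i) (B j) ≡ 0)
lemma3 d n A B _ _ leaf leaf-inj =
  outLabelInjective⇒deterministic G (outLabelInjective leaf-inj) ,
  graded⇒acyclic G rank rank-< ,
  mk⇔ (forked⇒orthogonal ∘ repeated⇒forked G (outLabelInjective leaf-inj) ∘ subst (HasRepeatedOfLength G) k+d+2≡)
      (subst (HasRepeatedOfLength G) (sym k+d+2≡) ∘ forked⇒repeated G ∘ orthogonal⇒forked)
  where
    open Construction d n A B leaf
    open ConstructionProperties d n A B leaf
    k+d+2≡ : k + d + 2 ≡ suc (suc (k + d))
    k+d+2≡ = +-comm (k + d) 2
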